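{- Let $G$ be a graph of order $n$ with $\min\{\delta(G),\delta(\overline{G})\}\geq k-1$. If $k\geq 2$, then \[ \gamma_{\times(k-1)}^{r}(G)+\gamma_{\times(k-1)}^{r}(\overline{G})\leq \gamma_{\times k}^{r}(G\overline{G}), \] and if $k\geq 1$, then \[ \gamma_{\times k}^{r}(G\overline{G})\leq \gamma_{\times k}^{r}(G)+\gamma_{\times k}^{r}(\overline{G}). \]
   Context: All graphs are finite, simple and undirected; $\overline{G}$ is the complement of $G$. The complementary prism $G\overline{G}$ is formed from the disjoint union of $G$ and $\overline{G}$ by adding the edges of a perfect matching joining each vertex of $G$ to its corresponding copy in $\overline{G}$. For an integer $j\geq 1$ and a graph $H=(V,E)$ with $\delta(H)\geq j-1$, with $N[x]$ the closed neighborhood of $x$: $S\subseteq V$ is a $j$-tuple restrained dominating set if $|N[x]\cap S|\geq j$ for all $x\in V$ and every vertex of $V-S$ has at least $j$ neighbors in $V-S$; $\gamma_{\times j}^{r}(H)$ is the minimum cardinality of such a set. -}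

module Defs where

open import Data.Nat.Base using (ℕ; zero; suc; _+_; _≤_; _≤ᵇ_; _⊓_)
open import Data.Bool using (Bool; true; false; not; _∧_; _∨_; if_then_else_)
open import Data.Fin using (Fin; splitAt)
open import Data.Fin.Properties using (_≟_)
open import Data.Fin.Subset using (Subset; ∣_∣; _∩_; ∁; ⊤)
open import Data.Sum using (inj₁; inj₂)
open import Data.Vec using (Vec; []; _∷_; tabulate; lookup)
open import Data.List.Base using (List; []; _∷_; _++_; map; foldr)
import Data.List.Base as L
open import Data.List.Base using (allFin)
open import Relation.Nullary using (yes; no)
open import Relation.Nullary.Decidable using (⌊_⌋)
open import Relation.Binary.PropositionalEquality using (_≡_; refl; sym; cong)

_==_ : ∀ {n} → Fin n → Fin n → Bool
x == y = ⌊ x ≟ y ⌋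

==-sym : ∀ {n} (x y : Fin n) → (x == y) ≡ (y == x)
==-sym x y with x ≟ y | y ≟ x
... | yes _ | yes _ = refl
... | no _ | no _ = refl
... | yes p | no q = Data.Empty.⊥-elim (q (sym p)) where import Data.Empty
... | no p | yes q = Data.Empty.⊥-elim (p (sym q)) where import Data.Empty

==-refl : ∀ {n} (x : Fin n) → (x == x) ≡ true
==-refl x with x ≟ x
... | yes _ = refl
... | no p = Data.Empty.⊥-elim (p refl) where import Data.Empty

record Graph (n : ℕ) : Set where
  field
    adj    : Fin n → Fin n → Bool
    adj-sym : ∀ x y → adj x y ≡ adj y x
    adj-irr : ∀ x → adj x x ≡ false
open Graph public

compl : ∀ {n} → Graph n → Graph n
adj (compl G) x y = not (adj G x y) ∧ not (x == y)
adj-sym (compl G) x y rewrite adj-sym G x y | ==-sym x y = refl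
adj-irr (compl G) x rewrite ==-refl x = Data.Bool.Properties.∧-zeroʳ (not (adj G x x))
  where import Data.Bool.Properties

-- complementary prism G Ḡ on Fin (n + n): vertices splitAt n = inj₁ x are
-- the copy of x in G, inj₂ x the copy of x in Ḡ; x in G is matched to x in Ḡ.
prismAdj : ∀ {n} → Graph n → Fin (n + n) → Fin (n + n) → Bool
prismAdj {n} G u v with splitAt n u | splitAt n v
... | inj₁ x | inj₁ y = adj G x y
... | inj₂ x | inj₂ y = adj (compl G) x y
... | inj₁ x | inj₂ y = x == y
... | inj₂ x | inj₁ y = x == y

prismAdj-sym : ∀ {n} (G : Graph n) u v → prismAdj G u v ≡ prismAdj G v u
prismAdj-sym {n} G u v with splitAt n u | splitAt n v
... | inj₁ x | inj₁ y = adj-sym G x y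
... | inj₂ x | inj₂ y = adj-sym (compl G) x y
... | inj₁ x | inj₂ y = ==-sym x y
... | inj₂ x | inj₁ y = ==-sym x y

prismAdj-irr : ∀ {n} (G : Graph n) u → prismAdj G u u ≡ false
prismAdj-irr {n} G u with splitAt n u
... | inj₁ x = adj-irr G x
... | inj₂ x = adj-irr (compl G) x

prism : ∀ {n} → Graph n → Graph (n + n)
adj (prism G) = prismAdj G
adj-sym (prism G) = prismAdj-sym G
adj-irr (prism G) = prismAdj-irr G

N : ∀ {n} → Graph n → Fin n → Subset n
N G x = tabulate (λ y → adj G x y)

N[_] : ∀ {n} → Graph n → Fin n → Subset n
N[ G ] x = tabulate (λ y → (x == y) ∨ adj G x y)

deg : ∀ {n} → Graph n → Fin n → ℕ
deg G x = ∣ N G x ∣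

MinDegGE : ∀ {n} → Graph n → ℕ → Set
MinDegGE G d = ∀ x → d ≤ deg G x

isTupleRDS : ∀ {n} → ℕ → Graph n → Subset n → Bool
isTupleRDS {n} j H S =
  L.and (L.map (λ x → j ≤ᵇ ∣ N[ H ] x ∩ S ∣) (allFin n))
  ∧ L.and (L.map (λ x → lookup S x ∨ (j ≤ᵇ ∣ N H x ∩ ∁ S ∣)) (allFin n))

allSubsets : (n : ℕ) → List (Subset n)
allSubsets zero = [] ∷ []
allSubsets (suc n) = map (true ∷_) (allSubsets n) ++ map (false ∷_) (allSubsets n)

-- The starting value n = |V(H)| is the size of the full vertex set, which is
-- itself such a set whenever δ(H) ≥ j - 1 (the standing assumption).
γ×r : ∀ {n} → ℕ → Graph n → ℕ
γ×r {n} j H =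
  foldr (λ S m → if isTupleRDS j H S then ∣ S ∣ ⊓ m else m) n (allSubsets n)

-- Restricted to one copy of G in the prism G Ḡ, a k-tuple restrained
-- dominating set loses, at every vertex, at most the single matched vertex of
-- the other copy from its closed and from its open neighbourhood; hence it
-- restricts to (k − 1)-tuple restrained dominating sets of G and of Ḡ whose
-- sizes add up to its own.  Conversely, k-tuple restrained dominating sets of
-- G and Ḡ placed side by side form one of G Ḡ, because every vertex of the
-- prism already sees enough of them inside its own copy.  The minimum-degree
-- hypotheses make the whole vertex set a k-tuple restrained dominating set, so
-- all the minima involved are attained.
module Submission where

open import Defs
open import Data.Nat using (ℕ; _+_; _∸_; _≤_)
open import Data.Product using (_×_)

open import Data.Nat using (suc; _⊓_; _≤ᵇ_; z≤n; s≤s)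
open import Data.Nat.Properties
  using ( ≤-trans; ≤-reflexive; m≤n⇒m≤1+n; +-comm; +-monoʳ-≤; +-mono-≤
        ; m≤m+n; m⊓n≤m; m⊓n≤n; ⊓-sel; ≤ᵇ⇒≤; ≤⇒≤ᵇ; m≤n+o⇒m∸n≤o; m≤n+m∸n; module ≤-Reasoning)
open import Data.Bool using (Bool; true; false; not; _∧_; _∨_; if_then_else_; T)
open import Data.Bool.Properties using (∧-identityʳ; T-∧)
open import Data.Empty using (⊥-elim)
open import Data.Fin using (Fin; splitAt; _↑ˡ_; _↑ʳ_)
import Data.Fin as Fin
open import Data.Fin.Properties
  using (_≟_; splitAt-↑ˡ; splitAt-↑ʳ; splitAt⁻¹-↑ˡ; splitAt⁻¹-↑ʳ; ↑ˡ-injective; ↑ʳ-injective)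
  renaming (suc-injective to Fin-suc-injective)
open import Data.Fin.Subset using (Subset; ∣_∣; _∩_; ∁)
open import Data.Fin.Subset.Properties using (∣p∣≤n)
open import Data.List.Base using (List; []; _∷_; map; foldr; allFin)
open import Data.List.Membership.Propositional using (_∈_)
open import Data.List.Membership.Propositional.Properties using (∈-map⁺; ∈-++⁺ˡ; ∈-++⁺ʳ)
open import Data.List.Relation.Unary.Any using (here; there)
open import Data.List.Relation.Unary.All.Properties using (all⁺; all⁻; tabulate⁺; tabulate⁻)
open import Data.Product using (Σ; _,_; proj₁; proj₂)
open import Data.Sum using (inj₁; inj₂; [_,_]′)
open import Data.Vec using ([]; _∷_; tabulate; lookup)
open import Data.Vec.Properties using (tabulate-cong; tabulate∘lookup; lookup∘tabulate; lookup-zipWith; lookup-map)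
open import Function using (_∘_)
open import Function.Bundles using (Equivalence)
open import Function.Definitions using (Injective)
open import Relation.Nullary using (yes; no)
open import Relation.Binary.PropositionalEquality
  using (_≡_; _≢_; _≗_; refl; sym; trans; cong; cong₂; subst)

==-injective : ∀ {m n} (g : Fin m → Fin n) → Injective _≡_ _≡_ g →
               ∀ a b → (g a == g b) ≡ (a == b)
==-injective g g-inj a b with a ≟ b | g a ≟ g b
... | yes refl | yes _     = refl
... | yes refl | no ga≢ga  = ⊥-elim (ga≢ga refl)
... | no a≢b   | yes ga≡gb = ⊥-elim (a≢b (g-inj ga≡gb))
... | no _     | no _      = refl

≢⇒==-false : ∀ {n} {x y : Fin n} → x ≢ y → (x == y) ≡ false
≢⇒==-false {x = x} {y} x≢y with x ≟ y
... | yes x≡y = ⊥-elim (x≢y x≡y)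
... | no _    = refl

suc==suc : ∀ {n} (x y : Fin n) → (Fin.suc x == Fin.suc y) ≡ (x == y)
suc==suc = ==-injective Fin.suc Fin-suc-injective

count : ∀ {n} → (Fin n → Bool) → ℕ
count f = ∣ tabulate f ∣

count-cong : ∀ {n} {f g : Fin n → Bool} → f ≗ g → count f ≡ count g
count-cong f≗g = cong ∣_∣ (tabulate-cong f≗g)

count-lookup : ∀ {n} (p : Subset n) → count (lookup p) ≡ ∣ p ∣
count-lookup p = cong ∣_∣ (tabulate∘lookup p)

count-mono : ∀ {n} {f g : Fin n → Bool} → (∀ i → T (f i) → T (g i)) → count f ≤ count g
count-mono {ℕ.zero} _ = z≤n
count-mono {suc n} {f} {g} f⇒g with f Fin.zero | g Fin.zero | f⇒g Fin.zero
... | true  | true  | _  = s≤s (count-mono (f⇒g ∘ Fin.suc))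
... | true  | false | f⇒g₀ = ⊥-elim (f⇒g₀ _)
... | false | true  | _  = m≤n⇒m≤1+n (count-mono (f⇒g ∘ Fin.suc))
... | false | false | _  = count-mono (f⇒g ∘ Fin.suc)

count-false : ∀ {n} → count {n} (λ _ → false) ≡ 0
count-false {ℕ.zero} = refl
count-false {suc n}  = count-false {n}

count-== : ∀ {n} (x : Fin n) → count (x ==_) ≡ 1
count-== {suc n} Fin.zero = cong suc (count-false {n})
count-== (Fin.suc x) = trans (count-cong (suc==suc x)) (count-== x)

count-==-∧-≤1 : ∀ {n} (x : Fin n) (h : Fin n → Bool) → count (λ y → (x == y) ∧ h y) ≤ 1
count-==-∧-≤1 x h =
  ≤-trans (count-mono {g = x ==_} (λ y → proj₁ ∘ Equivalence.to (T-∧ {x == y})))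
          (≤-reflexive (count-== x))

count-insert : ∀ {n} (x : Fin n) (g : Fin n → Bool) → g x ≡ false →
               count (λ y → (x == y) ∨ g y) ≡ suc (count g)
count-insert Fin.zero    g gx rewrite gx = refl
count-insert (Fin.suc x) g gx
  with g Fin.zero | trans (count-cong λ y → cong (_∨ g (Fin.suc y)) (suc==suc x y))
                          (count-insert x (g ∘ Fin.suc) gx)
... | true  | tail = cong suc tail
... | false | tail = tail

count-↑ : ∀ m {n} (f : Fin (m + n) → Bool) →
          count f ≡ count (f ∘ (_↑ˡ n)) + count (f ∘ (m ↑ʳ_))
count-↑ ℕ.zero    f = refl
count-↑ (suc m) f with f Fin.zero
... | true  = cong suc (count-↑ m (f ∘ Fin.suc))
... | false = count-↑ m (f ∘ Fin.suc)

module _ {A : Set} (P : A → Bool) (c : A → ℕ) where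

  minimumOver : ℕ → List A → ℕ
  minimumOver b = foldr (λ a m → if P a then c a ⊓ m else m) b

  minimumOver-≤ : ∀ b {xs a} → a ∈ xs → T (P a) → minimumOver b xs ≤ c a
  minimumOver-≤ b {x ∷ xs} (here refl) Px with P x
  ... | true  = m⊓n≤m (c x) (minimumOver b xs)
  ... | false = ⊥-elim Px
  minimumOver-≤ b {x ∷ xs} (there a∈xs) Pa with P x
  ... | true  = ≤-trans (m⊓n≤n (c x) (minimumOver b xs)) (minimumOver-≤ b a∈xs Pa)
  ... | false = minimumOver-≤ b a∈xs Pa

  minimumOver-attained : ∀ b xs {w} → T (P w) → c w ≤ b →
                         Σ A λ a → T (P a) × c a ≤ minimumOver b xs
  minimumOver-attained b []       {w} Pw w≤b = w , Pw , w≤b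
  minimumOver-attained b (x ∷ xs) Pw w≤b
    with minimumOver-attained b xs Pw w≤b | P x in Px
  ... | a≤min | false = a≤min
  ... | a , Pa , a≤min | true with ⊓-sel (c x) (minimumOver b xs)
  ...   | inj₁ x≡min = x , subst T (sym Px) _ , ≤-reflexive (sym x≡min)
  ...   | inj₂ m≡min = a , Pa , ≤-trans a≤min (≤-reflexive (sym m≡min))

∈-allSubsets : ∀ {n} (S : Subset n) → S ∈ allSubsets n
∈-allSubsets []                = here refl
∈-allSubsets {suc n} (true ∷ S)  = ∈-++⁺ˡ (∈-map⁺ (true ∷_) (∈-allSubsets S))
∈-allSubsets {suc n} (false ∷ S) =
  ∈-++⁺ʳ (map (true ∷_) (allSubsets n)) (∈-map⁺ (false ∷_) (∈-allSubsets S))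

closedAdj : ∀ {n} → Graph n → Fin n → Fin n → Bool
closedAdj H x y = (x == y) ∨ adj H x y

record TupleRDSAt {n} (j : ℕ) (H : Graph n) (s : Fin n → Bool) (x : Fin n) : Set where
  field
    dominated  : j ≤ count (λ y → closedAdj H x y ∧ s y)
    restrained : s x ≡ false → j ≤ count (λ y → adj H x y ∧ not (s y))
open TupleRDSAt

TupleRDS : ∀ {n} → ℕ → Graph n → (Fin n → Bool) → Set
TupleRDS j H s = ∀ x → TupleRDSAt j H s x

TupleRDSAt-cong : ∀ {n j} {H : Graph n} {s t : Fin n → Bool} {x} → s ≗ t →
                  TupleRDSAt j H s x → TupleRDSAt j H t x
TupleRDSAt-cong {j = j} {H} {x = x} s≗t at = record
  { dominated  = subst (j ≤_) (count-cong λ y → cong (closedAdj H x y ∧_) (s≗t y)) (dominated at)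
  ; restrained = λ tx≡false → subst (j ≤_) (count-cong λ y → cong (λ b → adj H x y ∧ not b) (s≗t y))
                   (restrained at (trans (s≗t x) tx≡false))
  }

∣N[x]∩S∣≡count : ∀ {n} (H : Graph n) (S : Subset n) x →
                 ∣ N[ H ] x ∩ S ∣ ≡ count (λ y → closedAdj H x y ∧ lookup S y)
∣N[x]∩S∣≡count H S x = sym (trans (count-cong lookup-∩) (count-lookup (N[ H ] x ∩ S)))
  where
  lookup-∩ : ∀ y → closedAdj H x y ∧ lookup S y ≡ lookup (N[ H ] x ∩ S) y
  lookup-∩ y = sym (trans (lookup-zipWith _∧_ y (N[ H ] x) S)
                          (cong (_∧ lookup S y) (lookup∘tabulate (closedAdj H x) y)))

∣Nx∩∁S∣≡count : ∀ {n} (H : Graph n) (S : Subset n) x →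
                 ∣ N H x ∩ ∁ S ∣ ≡ count (λ y → adj H x y ∧ not (lookup S y))
∣Nx∩∁S∣≡count H S x = sym (trans (count-cong lookup-∩∁) (count-lookup (N H x ∩ ∁ S)))
  where
  lookup-∩∁ : ∀ y → adj H x y ∧ not (lookup S y) ≡ lookup (N H x ∩ ∁ S) y
  lookup-∩∁ y = sym (trans (lookup-zipWith _∧_ y (N H x) (∁ S))
                           (cong₂ _∧_ (lookup∘tabulate (adj H x) y) (lookup-map y not S)))

module _ {n} (j : ℕ) (H : Graph n) (S : Subset n) where

  isTupleRDS-sound : T (isTupleRDS j H S) → TupleRDS j H (lookup S)
  isTupleRDS-sound isRDS x = record
    { dominated  = subst (j ≤_) (∣N[x]∩S∣≡count H S x) (≤ᵇ⇒≤ j _ (dominatedᵇ x))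
    ; restrained = λ Sx≡false → subst (j ≤_) (∣Nx∩∁S∣≡count H S x)
                     (≤ᵇ⇒≤ j _ (subst (λ b → T (b ∨ (j ≤ᵇ ∣ N H x ∩ ∁ S ∣))) Sx≡false (restrainedᵇ x)))
    }
    where
    dominatedᵇ : ∀ x → T (j ≤ᵇ ∣ N[ H ] x ∩ S ∣)
    dominatedᵇ = tabulate⁻ (all⁺ _ (allFin n) (proj₁ (Equivalence.to T-∧ isRDS)))
    restrainedᵇ : ∀ x → T (lookup S x ∨ (j ≤ᵇ ∣ N H x ∩ ∁ S ∣))
    restrainedᵇ = tabulate⁻ (all⁺ _ (allFin n) (proj₂ (Equivalence.to T-∧ isRDS)))

  isTupleRDS-complete : TupleRDS j H (lookup S) → T (isTupleRDS j H S)
  isTupleRDS-complete rds = Equivalence.from T-∧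
    (all⁻ _ (tabulate⁺ dominatedᵇ) , all⁻ _ (tabulate⁺ restrainedᵇ))
    where
    dominatedᵇ : ∀ x → T (j ≤ᵇ ∣ N[ H ] x ∩ S ∣)
    dominatedᵇ x = ≤⇒≤ᵇ (subst (j ≤_) (sym (∣N[x]∩S∣≡count H S x)) (dominated (rds x)))
    restrainedᵇ : ∀ x → T (lookup S x ∨ (j ≤ᵇ ∣ N H x ∩ ∁ S ∣))
    restrainedᵇ x with lookup S x | restrained (rds x)
    ... | true  | _          = _
    ... | false | restrained′ =
      ≤⇒≤ᵇ (subst (j ≤_) (sym (∣Nx∩∁S∣≡count H S x)) (restrained′ refl))

module _ {n} {j : ℕ} {H : Graph n} where

  isTupleRDS-tabulate : ∀ {s} → TupleRDS j H s → T (isTupleRDS j H (tabulate s))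
  isTupleRDS-tabulate {s} rds = isTupleRDS-complete j H (tabulate s)
    (λ x → TupleRDSAt-cong (λ y → sym (lookup∘tabulate s y)) (rds x))

  γ×r-minimal : ∀ {s} → TupleRDS j H s → γ×r j H ≤ count s
  γ×r-minimal {s} rds =
    minimumOver-≤ (isTupleRDS j H) ∣_∣ n (∈-allSubsets (tabulate s)) (isTupleRDS-tabulate rds)

  -- The minimum is taken starting from n, which no vertex set can undercut.
  γ×r-attained : ∀ {s} → TupleRDS j H s → Σ (Fin n → Bool) λ t → TupleRDS j H t × count t ≤ γ×r j H
  γ×r-attained {s} rds
    with minimumOver-attained (isTupleRDS j H) ∣_∣ n (allSubsets n)
           (isTupleRDS-tabulate rds) (∣p∣≤n (tabulate s))
  ... | S , S-rds , S≤γ =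
    lookup S , isTupleRDS-sound j H S S-rds , subst (_≤ γ×r j H) (sym (count-lookup S)) S≤γ

full-TupleRDS : ∀ {n k} (H : Graph n) → MinDegGE H (k ∸ 1) → TupleRDS k H (λ _ → true)
full-TupleRDS {k = k} H δ≥k-1 x = record
  { dominated  = begin
      k                                       ≤⟨ m≤n+m∸n k 1 ⟩
      suc (k ∸ 1)                             ≤⟨ s≤s (δ≥k-1 x) ⟩
      suc (count (adj H x))                   ≡⟨ sym (count-insert x (adj H x) (adj-irr H x)) ⟩
      count (closedAdj H x)                   ≡⟨ count-cong (λ y → sym (∧-identityʳ (closedAdj H x y))) ⟩
      count (λ y → closedAdj H x y ∧ true)    ∎
  ; restrained = λ ()
  }
  where open ≤-Reasoning

-- H has a copy of G on the vertices inner x, each matched to outer x in the other copy.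
record PrismSide {n} (H : Graph (n + n)) (G : Graph n) : Set where
  field
    inner outer : Fin n → Fin (n + n)
    adj-inner   : ∀ x y → adj H (inner x) (inner y) ≡ adj G x y
    adj-outer   : ∀ x y → adj H (inner x) (outer y) ≡ (x == y)
    ==-inner    : ∀ x y → (inner x == inner y) ≡ (x == y)
    ==-outer    : ∀ x y → (inner x == outer y) ≡ false
    count-split : ∀ f → count f ≡ count (f ∘ inner) + count (f ∘ outer)

module _ {n} {H : Graph (n + n)} {G : Graph n} (side : PrismSide H G) where
  open PrismSide side

  count-closedAdj-split : ∀ (s : Fin (n + n) → Bool) x →
    count (λ u → closedAdj H (inner x) u ∧ s u)
      ≡ count (λ y → closedAdj G x y ∧ s (inner y)) + count (λ y → (x == y) ∧ s (outer y))
  count-closedAdj-split s x = trans (count-split _) (cong₂ _+_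
    (count-cong λ y → cong₂ (λ a b → (a ∨ b) ∧ s (inner y)) (==-inner x y) (adj-inner x y))
    (count-cong λ y → cong₂ (λ a b → (a ∨ b) ∧ s (outer y)) (==-outer x y) (adj-outer x y)))

  count-adj-split : ∀ (s : Fin (n + n) → Bool) x →
    count (λ u → adj H (inner x) u ∧ not (s u))
      ≡ count (λ y → adj G x y ∧ not (s (inner y))) + count (λ y → (x == y) ∧ not (s (outer y)))
  count-adj-split s x = trans (count-split _) (cong₂ _+_
    (count-cong λ y → cong (_∧ not (s (inner y))) (adj-inner x y))
    (count-cong λ y → cong (_∧ not (s (outer y))) (adj-outer x y)))

  TupleRDS-restrict : ∀ {k s} → TupleRDS k H s → TupleRDS (k ∸ 1) G (s ∘ inner)
  TupleRDS-restrict {k} {s} rds x = record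
    { dominated  = drop-matched (dominated (rds (inner x)))
                     (count-closedAdj-split s x) (count-==-∧-≤1 x (s ∘ outer))
    ; restrained = λ sx≡false → drop-matched (restrained (rds (inner x)) sx≡false)
                     (count-adj-split s x) (count-==-∧-≤1 x (not ∘ s ∘ outer))
    }
    where
    drop-matched : ∀ {total side matched} → k ≤ total → total ≡ side + matched →
                   matched ≤ 1 → k ∸ 1 ≤ side
    drop-matched {total} {side} {matched} k≤total total≡ matched≤1 = m≤n+o⇒m∸n≤o k 1 (begin
      k              ≤⟨ k≤total ⟩
      total          ≡⟨ total≡ ⟩
      side + matched ≤⟨ +-monoʳ-≤ side matched≤1 ⟩
      side + 1       ≡⟨ +-comm side 1 ⟩
      1 + side       ∎)
      where open ≤-Reasoning

  TupleRDSAt-extend : ∀ {k s x} → TupleRDSAt k G (s ∘ inner) x → TupleRDSAt k H s (inner x)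
  TupleRDSAt-extend {k} {s} {x} at = record
    { dominated  = ≤-trans (dominated at)
                     (≤-trans (m≤m+n _ _) (≤-reflexive (sym (count-closedAdj-split s x))))
    ; restrained = λ sx≡false → ≤-trans (restrained at sx≡false)
                     (≤-trans (m≤m+n _ _) (≤-reflexive (sym (count-adj-split s x))))
    }

↑ˡ≢↑ʳ : ∀ {n} (x y : Fin n) → x ↑ˡ n ≢ n ↑ʳ y
↑ˡ≢↑ʳ {n} x y eq
  with trans (sym (splitAt-↑ˡ n x n)) (trans (cong (splitAt n) eq) (splitAt-↑ʳ n n y))
... | ()

module _ {n : ℕ} where

  _⊕_ : (Fin n → Bool) → (Fin n → Bool) → Fin (n + n) → Bool
  (a ⊕ b) u = [ a , b ]′ (splitAt n u)

  ⊕-↑ˡ : ∀ a b x → (a ⊕ b) (x ↑ˡ n) ≡ a x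
  ⊕-↑ˡ a b x = cong [ a , b ]′ (splitAt-↑ˡ n x n)

  ⊕-↑ʳ : ∀ a b x → (a ⊕ b) (n ↑ʳ x) ≡ b x
  ⊕-↑ʳ a b x = cong [ a , b ]′ (splitAt-↑ʳ n n x)

  count-⊕ : ∀ a b → count (a ⊕ b) ≡ count a + count b
  count-⊕ a b = trans (count-↑ n (a ⊕ b)) (cong₂ _+_ (count-cong (⊕-↑ˡ a b)) (count-cong (⊕-↑ʳ a b)))

module _ {n} (G : Graph n) where

  prismAdj-↑ˡ-↑ˡ : ∀ x y → prismAdj G (x ↑ˡ n) (y ↑ˡ n) ≡ adj G x y
  prismAdj-↑ˡ-↑ˡ x y rewrite splitAt-↑ˡ n x n | splitAt-↑ˡ n y n = refl

  prismAdj-↑ʳ-↑ʳ : ∀ x y → prismAdj G (n ↑ʳ x) (n ↑ʳ y) ≡ adj (compl G) x y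
  prismAdj-↑ʳ-↑ʳ x y rewrite splitAt-↑ʳ n n x | splitAt-↑ʳ n n y = refl

  prismAdj-↑ˡ-↑ʳ : ∀ x y → prismAdj G (x ↑ˡ n) (n ↑ʳ y) ≡ (x == y)
  prismAdj-↑ˡ-↑ʳ x y rewrite splitAt-↑ˡ n x n | splitAt-↑ʳ n n y = refl

  prismAdj-↑ʳ-↑ˡ : ∀ x y → prismAdj G (n ↑ʳ x) (y ↑ˡ n) ≡ (x == y)
  prismAdj-↑ʳ-↑ˡ x y rewrite splitAt-↑ʳ n n x | splitAt-↑ˡ n y n = refl

  prismSideˡ : PrismSide (prism G) G
  prismSideˡ = record
    { inner       = _↑ˡ n
    ; outer       = n ↑ʳ_
    ; adj-inner   = prismAdj-↑ˡ-↑ˡ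
    ; adj-outer   = prismAdj-↑ˡ-↑ʳ
    ; ==-inner    = ==-injective (_↑ˡ n) (↑ˡ-injective n _ _)
    ; ==-outer    = λ x y → ≢⇒==-false (↑ˡ≢↑ʳ x y)
    ; count-split = count-↑ n
    }

  prismSideʳ : PrismSide (prism G) (compl G)
  prismSideʳ = record
    { inner       = n ↑ʳ_
    ; outer       = _↑ˡ n
    ; adj-inner   = prismAdj-↑ʳ-↑ʳ
    ; adj-outer   = prismAdj-↑ʳ-↑ˡ
    ; ==-inner    = ==-injective (n ↑ʳ_) (↑ʳ-injective n _ _)
    ; ==-outer    = λ x y → ≢⇒==-false (↑ˡ≢↑ʳ y x ∘ sym)
    ; count-split = λ f → trans (count-↑ n f) (+-comm (count (f ∘ (_↑ˡ n))) (count (f ∘ (n ↑ʳ_))))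
    }

  TupleRDS-⊕ : ∀ {k a b} → TupleRDS k G a → TupleRDS k (compl G) b → TupleRDS k (prism G) (a ⊕ b)
  TupleRDS-⊕ {k} {a} {b} rds-a rds-b u with splitAt n u in split-u
  ... | inj₁ x = subst (TupleRDSAt k (prism G) (a ⊕ b)) (splitAt⁻¹-↑ˡ split-u)
                   (TupleRDSAt-extend prismSideˡ (TupleRDSAt-cong (sym ∘ ⊕-↑ˡ a b) (rds-a x)))
  ... | inj₂ x = subst (TupleRDSAt k (prism G) (a ⊕ b)) (splitAt⁻¹-↑ʳ split-u)
                   (TupleRDSAt-extend prismSideʳ (TupleRDSAt-cong (sym ∘ ⊕-↑ʳ a b) (rds-b x)))

theorem5p5 : ∀ {n : ℕ} (G : Graph n) (k : ℕ) →
    MinDegGE G (k ∸ 1) → MinDegGE (compl G) (k ∸ 1) →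
    (2 ≤ k → γ×r (k ∸ 1) G + γ×r (k ∸ 1) (compl G) ≤ γ×r k (prism G))
    × (1 ≤ k → γ×r k (prism G) ≤ γ×r k G + γ×r k (compl G))
theorem5p5 {n} G k δG≥k-1 δḠ≥k-1 = lower-bound , upper-bound
  where
  open ≤-Reasoning
  fullᴳ : TupleRDS k G (λ _ → true)
  fullᴳ = full-TupleRDS G δG≥k-1
  fullᴳ̄ : TupleRDS k (compl G) (λ _ → true)
  fullᴳ̄ = full-TupleRDS (compl G) δḠ≥k-1

  -- Neither bound needs its hypothesis on k: for k ≤ 1 they hold with k ∸ 1 = 0.
  lower-bound : 2 ≤ k → γ×r (k ∸ 1) G + γ×r (k ∸ 1) (compl G) ≤ γ×r k (prism G)
  lower-bound _ with γ×r-attained (TupleRDS-⊕ G fullᴳ fullᴳ̄)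
  ... | s , s-rds , s≤γ = begin
    γ×r (k ∸ 1) G + γ×r (k ∸ 1) (compl G)
      ≤⟨ +-mono-≤ (γ×r-minimal (TupleRDS-restrict (prismSideˡ G) s-rds))
                  (γ×r-minimal (TupleRDS-restrict (prismSideʳ G) s-rds)) ⟩
    count (s ∘ (_↑ˡ n)) + count (s ∘ (n ↑ʳ_))  ≡⟨ count-↑ n s ⟨
    count s                                    ≤⟨ s≤γ ⟩
    γ×r k (prism G)                            ∎

  upper-bound : 1 ≤ k → γ×r k (prism G) ≤ γ×r k G + γ×r k (compl G)
  upper-bound _ with γ×r-attained fullᴳ | γ×r-attained fullᴳ̄
  ... | a , a-rds , a≤γ | b , b-rds , b≤γ = begin
    γ×r k (prism G)            ≤⟨ γ×r-minimal (TupleRDS-⊕ G a-rds b-rds) ⟩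
    count (a ⊕ b)              ≡⟨ count-⊕ a b ⟩
    count a + count b          ≤⟨ +-mono-≤ a≤γ b≤γ ⟩
    γ×r k G + γ×r k (compl G)  ∎
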